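{- Let $G$ be a finite group of even order, and let $T=\{g\in G: g^2=1\}$ be the set consisting of the identity and the involutions of $G$. Let $X(G)$ be any simple undirected graph with vertex set $G$ such that every element $g\in G\setminus T$ is adjacent to its inverse $g^{ -1}$. Then there is a matching of maximum size in $X(G)$ for which the set of unmatched vertices is contained in $T$.
   Context: A matching in a graph is a set of edges no two of which share a vertex; a vertex is matched if it lies on an edge of the matching and unmatched otherwise. -}

module Defs where

open import Data.Nat using (ℕ)
open import Data.Fin using (Fin)
open import Data.Bool using (Bool; true; false)
open import Data.Product using (_×_; _,_; proj₁; proj₂)
open import Data.Sum using (_⊎_)
open import Data.List using (List)
open import Data.List.Relation.Unary.All using (All)
open import Data.List.Relation.Unary.Any using (Any)
open import Data.List.Relation.Unary.AllPairs using (AllPairs)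
open import Relation.Binary.PropositionalEquality using (_≡_; _≢_)
open import Relation.Nullary using (¬_)

record SimpleGraph (n : ℕ) : Set where
  field
    adj     : Fin n → Fin n → Bool
    sym     : ∀ x y → adj x y ≡ adj y x
    irrefl  : ∀ x → adj x x ≡ false

-- An edge is written as an (unordered, but stored as ordered) pair of vertices.
Edge : ℕ → Set
Edge n = Fin n × Fin n

VertexDisjoint : ∀ {n} → Edge n → Edge n → Set
VertexDisjoint (a , b) (c , d) = (a ≢ c) × (a ≢ d) × (b ≢ c) × (b ≢ d)

IsMatching : ∀ {n} → SimpleGraph n → List (Edge n) → Set
IsMatching X M =
  All (λ e → SimpleGraph.adj X (proj₁ e) (proj₂ e) ≡ true) M × AllPairs VertexDisjoint M

Matched : ∀ {n} → Fin n → List (Edge n) → Set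
Matched v M = Any (λ e → (proj₁ e ≡ v) ⊎ (proj₂ e ≡ v)) M

{-# OPTIONS --safe #-}
module Submission where

-- Inversion σ is an involution of G whose fixed points are exactly T, and
-- every vertex moved by σ is adjacent to its image.  Among the maximum
-- matchings take one with the largest number of edges {v, σ v}.  If some v
-- outside T were unmatched, then either σ v is unmatched too, and adding
-- {v, σ v} gives a larger matching, or σ v is matched by an edge that is not
-- of the form {u, σ u} (its σ-partner would be v), and trading that edge for
-- {v, σ v} gives a maximum matching with more such edges.

open import Defs
open import Data.Nat using (ℕ; zero; suc; _≤_; s≤s)
import Data.Nat as ℕ
open import Data.Nat.Properties using (1+n≰n; ≰⇒>)
open import Data.Nat.Divisibility using (_∣_)
open import Data.Fin using (Fin; _≟_; _<_)
open import Data.Fin.Properties using (pigeonhole)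
open import Data.Bool using (true; false)
import Data.Bool as Bool
open import Data.Product using (Σ; ∃-syntax; _×_; _,_; proj₁; proj₂; uncurry)
open import Data.Sum using (_⊎_; inj₁; inj₂)
open import Data.List
  using (List; []; _∷_; [_]; length; lookup; filter; allFin; cartesianProduct; cartesianProductWith)
open import Data.List.Properties using (filter-accept; filter-reject; length-removeAt′)
open import Data.List.Extrema.Nat using (argmax; argmax-all; f[xs]≤f[argmax])
open import Data.List.Membership.Propositional using (_∈_)
open import Data.List.Membership.Propositional.Properties
  using (∈-lookup; ∈-filter⁺; ∈-allFin; ∈-cartesianProduct⁺; ∈-cartesianProductWith⁺)
open import Data.List.Relation.Unary.All as All using (All; []; _∷_)
open import Data.List.Relation.Unary.All.Properties using (all-filter; ─⁺; ¬Any⇒All¬; All¬⇒¬Any)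
open import Data.List.Relation.Unary.Any as Any using (Any; here; there; any?; _─_; index)
open import Data.List.Relation.Unary.AllPairs using (AllPairs; []; _∷_; allPairs?)
open import Algebra.Bundles using (Group)
open import Algebra.Definitions using (Involutive)
open import Algebra.Structures using (IsGroup)
import Algebra.Properties.Group as GroupProperties
open import Function using (_∘_)
open import Relation.Binary.PropositionalEquality using (_≡_; _≢_; refl; sym; trans; cong; subst)
open import Relation.Nullary using (¬_; Dec; yes; no; does; contradiction)
open import Relation.Nullary.Decidable using (_×-dec_; _⊎-dec_; ¬?)
open import Relation.Unary using (Decidable)

private
  variable
    A : Set
    n : ℕ

listsOfLength≤ : List A → ℕ → List (List A)
listsOfLength≤ xs zero    = [ [] ]
listsOfLength≤ xs (suc k) = [] ∷ cartesianProductWith _∷_ xs (listsOfLength≤ xs k)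

∈-listsOfLength≤ : ∀ {xs ys : List A} k → (∀ x → x ∈ xs) → length ys ≤ k → ys ∈ listsOfLength≤ xs k
∈-listsOfLength≤ {ys = []}     zero    _   _         = here refl
∈-listsOfLength≤ {ys = []}     (suc k) _   _         = here refl
∈-listsOfLength≤ {ys = y ∷ ys} (suc k) all (s≤s ≤k) =
  there (∈-cartesianProductWith⁺ _∷_ (all y) (∈-listsOfLength≤ k all ≤k))

∃-maximum : {P : A → Set} → Decidable P → (xs : List A) → (∀ {x} → P x → x ∈ xs) →
            (f : A → ℕ) → ∀ {x₀} → P x₀ → ∃[ m ] P m × (∀ {x} → P x → f x ≤ f m)
∃-maximum P? xs P⊆xs f {x₀} Px₀ =
  argmax f x₀ (filter P? xs) ,
  argmax-all f Px₀ (all-filter P? xs) ,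
  λ Px → All.lookup (f[xs]≤f[argmax] {f = f} x₀ (filter P? xs)) (∈-filter⁺ P? (P⊆xs Px) Px)

AllPairs-lookup : ∀ {R : A → A → Set} {xs : List A} → AllPairs R xs →
                  ∀ {i j} → i < j → R (lookup xs i) (lookup xs j)
AllPairs-lookup (Rx ∷ _)  {Fin.zero}  {Fin.suc j} _         = All.lookup Rx (∈-lookup j)
AllPairs-lookup (_ ∷ Rxs) {Fin.suc i} {Fin.suc j} (s≤s i<j) = AllPairs-lookup Rxs i<j

AllPairs-─ : ∀ {R : A → A → Set} {P : A → Set} {xs : List A} →
             AllPairs R xs → (p : Any P xs) → AllPairs R (xs ─ p)
AllPairs-─ (_ ∷ Rxs)  (here _)  = Rxs
AllPairs-─ (Rx ∷ Rxs) (there p) = ─⁺ p Rx ∷ AllPairs-─ Rxs p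

filter-─ : ∀ {P Q : A → Set} (P? : Decidable P) {xs : List A} (q : Any Q xs) →
           ¬ P (Any.lookup q) → filter P? (xs ─ q) ≡ filter P? xs
filter-─ P? (here _) ¬Pq = sym (filter-reject P? ¬Pq)
filter-─ P? {x ∷ _} (there q) ¬Pq with does (P? x)
... | true  = cong (x ∷_) (filter-─ P? q ¬Pq)
... | false = filter-─ P? q ¬Pq

Incident : Fin n → Edge n → Set
Incident v e = (proj₁ e ≡ v) ⊎ (proj₂ e ≡ v)

incident? : (v : Fin n) → Decidable (Incident v)
incident? v e = (proj₁ e ≟ v) ⊎-dec (proj₂ e ≟ v)

vertexDisjoint? : (e f : Edge n) → Dec (VertexDisjoint e f)
vertexDisjoint? (a , b) (c , d) = ¬? (a ≟ c) ×-dec ¬? (a ≟ d) ×-dec ¬? (b ≟ c) ×-dec ¬? (b ≟ d)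

VertexDisjoint-sym : {e f : Edge n} → VertexDisjoint e f → VertexDisjoint f e
VertexDisjoint-sym {e = _ , _} {f = _ , _} (a≢c , a≢d , b≢c , b≢d) =
  a≢c ∘ sym , b≢c ∘ sym , a≢d ∘ sym , b≢d ∘ sym

VertexDisjoint⇒¬Incident : ∀ {v} {e f : Edge n} → VertexDisjoint e f → Incident v e → ¬ Incident v f
VertexDisjoint⇒¬Incident {e = _ , _} {f = _ , _} (a≢c , _ , _ , _) (inj₁ refl) (inj₁ refl) = a≢c refl
VertexDisjoint⇒¬Incident {e = _ , _} {f = _ , _} (_ , a≢d , _ , _) (inj₁ refl) (inj₂ refl) = a≢d refl
VertexDisjoint⇒¬Incident {e = _ , _} {f = _ , _} (_ , _ , b≢c , _) (inj₂ refl) (inj₁ refl) = b≢c refl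
VertexDisjoint⇒¬Incident {e = _ , _} {f = _ , _} (_ , _ , _ , b≢d) (inj₂ refl) (inj₂ refl) = b≢d refl

¬Incident⇒VertexDisjoint : ∀ {v w} {f : Edge n} → ¬ Incident v f → ¬ Incident w f → VertexDisjoint (v , w) f
¬Incident⇒VertexDisjoint {f = _ , _} ¬v ¬w =
  ¬v ∘ inj₁ ∘ sym , ¬v ∘ inj₂ ∘ sym , ¬w ∘ inj₁ ∘ sym , ¬w ∘ inj₂ ∘ sym

allEdges : (n : ℕ) → List (Edge n)
allEdges n = cartesianProduct (allFin n) (allFin n)

∈-allEdges : (e : Edge n) → e ∈ allEdges n
∈-allEdges (a , b) = ∈-cartesianProduct⁺ (∈-allFin a) (∈-allFin b)

length-VertexDisjoint≤ : {M : List (Edge n)} → AllPairs VertexDisjoint M → length M ≤ n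
length-VertexDisjoint≤ {n = n} {M} disjoint with length M ℕ.≤? n
... | yes ≤n = ≤n
... | no  ≰n with pigeonhole (≰⇒> ≰n) (proj₁ ∘ lookup M)
...   | i , j , i<j , same-start = contradiction same-start (proj₁ (AllPairs-lookup disjoint i<j))

─-unmatched : ∀ {M : List (Edge n)} {w} → AllPairs VertexDisjoint M → (p : Any (Incident w) M) →
              All (¬_ ∘ Incident w) (M ─ p)
─-unmatched (disjoint ∷ _) (here w∈e) =
  All.map (λ e#f → VertexDisjoint⇒¬Incident e#f w∈e) disjoint
─-unmatched (disjoint ∷ disjoints) (there p) =
  let e#f , w∈f = All.lookupAny disjoint p
  in VertexDisjoint⇒¬Incident (VertexDisjoint-sym e#f) w∈f ∷ ─-unmatched disjoints p

Maximum : SimpleGraph n → List (Edge n) → Set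
Maximum X M = ∀ M′ → IsMatching X M′ → length M′ ≤ length M

module _ (X : SimpleGraph n) where

  open SimpleGraph X using (adj)

  isMatching? : Decidable (IsMatching X)
  isMatching? M = All.all? (λ e → adj (proj₁ e) (proj₂ e) Bool.≟ true) M ×-dec allPairs? vertexDisjoint? M

  ∈-matchings : ∀ {M} → IsMatching X M → M ∈ listsOfLength≤ (allEdges n) n
  ∈-matchings (_ , disjoint) = ∈-listsOfLength≤ _ ∈-allEdges (length-VertexDisjoint≤ disjoint)

  ∃-maximumMatching : (f : List (Edge n) → ℕ) →
    ∃[ M ] IsMatching X M × Maximum X M ×
           (∀ M′ → IsMatching X M′ → length M′ ≡ length M → f M′ ≤ f M)
  ∃-maximumMatching f =
    let M₀ , M₀-matching , M₀-maximum =
          ∃-maximum isMatching? _ ∈-matchings length {[]} ([] , [])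
        M , (M-matching , ∣M∣≡∣M₀∣) , M-f-maximum =
          ∃-maximum (λ M → isMatching? M ×-dec (length M ℕ.≟ length M₀)) _
                    (∈-matchings ∘ proj₁) f (M₀-matching , refl)
    in M , M-matching ,
       (λ M′ M′-matching → subst (length M′ ≤_) (sym ∣M∣≡∣M₀∣) (M₀-maximum M′-matching)) ,
       λ M′ M′-matching ∣M′∣≡∣M∣ → M-f-maximum (M′-matching , trans ∣M′∣≡∣M∣ ∣M∣≡∣M₀∣)

  augment : ∀ {M v w} → IsMatching X M → adj v w ≡ true →
            ¬ Matched v M → ¬ Matched w M → IsMatching X ((v , w) ∷ M)
  augment {M} (edges , disjoint) vw ¬v ¬w =
    vw ∷ edges ,
    All.zipWith (uncurry ¬Incident⇒VertexDisjoint) (¬Any⇒All¬ M ¬v , ¬Any⇒All¬ M ¬w) ∷ disjoint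

  exchange : ∀ {M v w} → IsMatching X M → adj v w ≡ true → ¬ Matched v M →
             (p : Any (Incident w) M) → IsMatching X ((v , w) ∷ (M ─ p))
  exchange {M} (edges , disjoint) vw ¬v p =
    augment (─⁺ p edges , AllPairs-─ disjoint p) vw
            (All¬⇒¬Any (─⁺ p (¬Any⇒All¬ M ¬v))) (All¬⇒¬Any (─-unmatched disjoint p))

module _ (σ : Fin n → Fin n) where

  OrbitEdge : Edge n → Set
  OrbitEdge e = proj₂ e ≡ σ (proj₁ e)

  orbitEdges : List (Edge n) → ℕ
  orbitEdges M = length (filter (λ e → proj₂ e ≟ σ (proj₁ e)) M)

  -- an orbit edge at σ v is {σ v, v} or {σ⁻¹ (σ v), σ v}, so it meets v
  Incident∧¬Incident⇒¬OrbitEdge : Involutive _≡_ σ → ∀ {v} {e : Edge n} →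
                                   Incident (σ v) e → ¬ Incident v e → ¬ OrbitEdge e
  Incident∧¬Incident⇒¬OrbitEdge σ-inv {v} {_ , _} (inj₁ refl) ¬v refl = ¬v (inj₂ (σ-inv v))
  Incident∧¬Incident⇒¬OrbitEdge σ-inv {v} {a , _} (inj₂ σa≡σv) ¬v refl =
    ¬v (inj₁ (trans (sym (σ-inv a)) (trans (cong σ σa≡σv) (σ-inv v))))

  orbitEdges-exchange : Involutive _≡_ σ → ∀ {M v} → ¬ Matched v M → (p : Any (Incident (σ v)) M) →
                        orbitEdges ((v , σ v) ∷ (M ─ p)) ≡ suc (orbitEdges M)
  orbitEdges-exchange σ-inv {M} ¬v p =
    let ¬v∈e , σv∈e = All.lookupAny (¬Any⇒All¬ M ¬v) p
    in trans (cong length (filter-accept (λ e → proj₂ e ≟ σ (proj₁ e)) refl))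
             (cong (suc ∘ length) (filter-─ _ p (Incident∧¬Incident⇒¬OrbitEdge σ-inv σv∈e ¬v∈e)))

module _ (X : SimpleGraph n) (σ : Fin n → Fin n) (σ-inv : Involutive _≡_ σ)
         (adj-σ : ∀ v → σ v ≢ v → SimpleGraph.adj X v (σ v) ≡ true) where

  unmatched-fixed : ∀ {M} → IsMatching X M → Maximum X M →
                    (∀ M′ → IsMatching X M′ → length M′ ≡ length M → orbitEdges σ M′ ≤ orbitEdges σ M) →
                    ∀ v → ¬ Matched v M → σ v ≡ v
  unmatched-fixed {M} matching maximum orbit-maximum v ¬v with σ v ≟ v
  ... | yes fixed = fixed
  ... | no  moved with any? (incident? (σ v)) M
  ...   | no ¬σv = contradiction (maximum _ (augment X matching (adj-σ v moved) ¬v ¬σv)) 1+n≰n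
  ...   | yes p  = contradiction
          (subst (_≤ orbitEdges σ M) (orbitEdges-exchange σ σ-inv ¬v p)
                 (orbit-maximum _ (exchange X matching (adj-σ v moved) ¬v p)
                                  (sym (length-removeAt′ M (index p)))))
          1+n≰n

  ∃-maximumMatching-unmatched-fixed :
    ∃[ M ] IsMatching X M × Maximum X M × (∀ v → ¬ Matched v M → σ v ≡ v)
  ∃-maximumMatching-unmatched-fixed =
    let M , matching , maximum , orbit-maximum = ∃-maximumMatching X (orbitEdges σ)
    in M , matching , maximum , unmatched-fixed matching maximum orbit-maximum

mainTheorem1 : (n : ℕ) → (_∙_ : Fin n → Fin n → Fin n) → (e : Fin n) → (inv : Fin n → Fin n)
    → IsGroup _≡_ _∙_ e inv
    → 2 ∣ n
    → (X : SimpleGraph n)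
    → (∀ g → ¬ ((g ∙ g) ≡ e) → SimpleGraph.adj X g (inv g) ≡ true)
    → Σ (List (Edge n)) (λ M → IsMatching X M
        × (∀ M′ → IsMatching X M′ → length M′ ≤ length M)
        × (∀ v → ¬ Matched v M → (v ∙ v) ≡ e))
mainTheorem1 n _∙_ e inv isGroup _ X adj-inv =
  let M , matching , maximum , unmatched-fixed =
        ∃-maximumMatching-unmatched-fixed X inv ⁻¹-involutive
          (λ g inv-g≢g → adj-inv g (inv-g≢g ∘ sym ∘ inverseʳ-unique g g))
  in M , matching , maximum ,
     λ v ¬v → trans (cong (v ∙_) (sym (unmatched-fixed v ¬v))) (IsGroup.inverseʳ isGroup v)
  where
  group : Group _ _
  group = record { isGroup = isGroup }

  open GroupProperties group using (⁻¹-involutive; inverseʳ-unique)
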